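{- Let $\underline{D}$ be a pure double Boolean algebra. If $\underline{D}$ is of type $I$, then the lattices $\mathrm{Con}(\underline{D})$ and $\mathrm{Con}(\underline{D}_\sqcap)$ are isomorphic; if $\underline{D}$ is of type $II$, then the lattices $\mathrm{Con}(\underline{D})$ and $\mathrm{Con}(\underline{D}_\sqcup)$ are isomorphic.
   Context: A double Boolean algebra (dBa) is an algebra $\underline{D}=(D;\sqcap,\sqcup,\neg,\lrcorner,\bot,\top)$ of type $(2,2,1,1,0,0)$ satisfying, for all $x,y,z$, where $x\vee y:=\neg(\neg x\sqcap\neg y)$ and $x\wedge y:=\lrcorner(\lrcorner x\sqcup\lrcorner y)$: $(x\sqcap x)\sqcap y=x\sqcap y$; $(x\sqcup x)\sqcup y=x\sqcup y$; $\sqcap$ and $\sqcup$ are commutative and associative; $x\sqcap(x\sqcup y)=x\sqcap x$; $x\sqcup(x\sqcap y)=x\sqcup x$; $x\sqcap(x\vee y)=x\sqcap x$; $x\sqcup(x\wedge y)=x\sqcup x$; $x\sqcap(y\vee z)=(x\sqcap y)\vee(x\sqcap z)$; $x\sqcup(y\wedge z)=(x\sqcup y)\wedge(x\sqcup z)$; $\neg\neg(x\sqcap y)=x\sqcap y$; $\lrcorner\lrcorner(x\sqcup y)=x\sqcup y$; $\neg(x\sqcap x)=\neg x$; $\lrcorner(x\sqcup x)=\lrcorner x$; $x\sqcap\neg x=\bot$; $x\sqcup\lrcorner x=\top$; $\neg\bot=\top\sqcap\top$; $\lrcorner\top=\bot\sqcup\bot$; $\neg\top=\bot$; $\lrcorner\bot=\top$;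 $(x\sqcap x)\sqcup(x\sqcap x)=(x\sqcup x)\sqcap(x\sqcup x)$. $D_\sqcap=\{x: x\sqcap x=x\}$, $D_\sqcup=\{x: x\sqcup x=x\}$; $\underline{D}_\sqcap=(D_\sqcap;\sqcap,\vee,\neg,\bot,\neg\bot)$ and $\underline{D}_\sqcup=(D_\sqcup;\wedge,\sqcup,\lrcorner,\lrcorner\top,\top)$ are Boolean algebras (a known fact). $\underline{D}$ is pure if $D=D_\sqcap\cup D_\sqcup$; of type $I$ if $D_\sqcup=\{\top\}$; of type $II$ if $D_\sqcap=\{\bot\}$. $\mathrm{Con}(\underline{A})$ is the congruence lattice of an algebra $\underline{A}$. -}

module Defs where

open import Relation.Binary.PropositionalEquality using (_≡_)
open import Data.Product using (_×_; Σ)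
open import Data.Sum using (_⊎_)

record DBA : Set₁ where
  infixr 7 _⊓_
  infixr 6 _⊔_
  field
    Carrier : Set
    _⊓_ _⊔_ : Carrier → Carrier → Carrier
    ¬_ ⌟_   : Carrier → Carrier
    ⊥ ⊤     : Carrier

  _∨_ : Carrier → Carrier → Carrier
  x ∨ y = ¬ ((¬ x) ⊓ (¬ y))

  _∧_ : Carrier → Carrier → Carrier
  x ∧ y = ⌟ ((⌟ x) ⊔ (⌟ y))

  field
    ⊓-idem′   : ∀ x y → (x ⊓ x) ⊓ y ≡ x ⊓ y
    ⊔-idem′   : ∀ x y → (x ⊔ x) ⊔ y ≡ x ⊔ y
    ⊓-comm    : ∀ x y → x ⊓ y ≡ y ⊓ x
    ⊔-comm    : ∀ x y → x ⊔ y ≡ y ⊔ x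
    ⊓-assoc   : ∀ x y z → x ⊓ (y ⊓ z) ≡ (x ⊓ y) ⊓ z
    ⊔-assoc   : ∀ x y z → x ⊔ (y ⊔ z) ≡ (x ⊔ y) ⊔ z
    ⊓-abs-⊔   : ∀ x y → x ⊓ (x ⊔ y) ≡ x ⊓ x
    ⊔-abs-⊓   : ∀ x y → x ⊔ (x ⊓ y) ≡ x ⊔ x
    ⊓-abs-∨   : ∀ x y → x ⊓ (x ∨ y) ≡ x ⊓ x
    ⊔-abs-∧   : ∀ x y → x ⊔ (x ∧ y) ≡ x ⊔ x
    ⊓-distrib-∨ : ∀ x y z → x ⊓ (y ∨ z) ≡ (x ⊓ y) ∨ (x ⊓ z)
    ⊔-distrib-∧ : ∀ x y z → x ⊔ (y ∧ z) ≡ (x ⊔ y) ∧ (x ⊔ z)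
    ¬¬-⊓      : ∀ x y → ¬ (¬ (x ⊓ y)) ≡ x ⊓ y
    ⌟⌟-⊔      : ∀ x y → ⌟ (⌟ (x ⊔ y)) ≡ x ⊔ y
    ¬-⊓-idem  : ∀ x → ¬ (x ⊓ x) ≡ ¬ x
    ⌟-⊔-idem  : ∀ x → ⌟ (x ⊔ x) ≡ ⌟ x
    ⊓-compl   : ∀ x → x ⊓ (¬ x) ≡ ⊥
    ⊔-compl   : ∀ x → x ⊔ (⌟ x) ≡ ⊤
    ¬⊥        : ¬ ⊥ ≡ ⊤ ⊓ ⊤
    ⌟⊤        : ⌟ ⊤ ≡ ⊥ ⊔ ⊥
    ¬⊤        : ¬ ⊤ ≡ ⊥
    ⌟⊥        : ⌟ ⊥ ≡ ⊤
    mixed     : ∀ x → (x ⊓ x) ⊔ (x ⊓ x) ≡ (x ⊔ x) ⊓ (x ⊔ x)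

  InD⊓ : Carrier → Set
  InD⊓ x = x ⊓ x ≡ x

  InD⊔ : Carrier → Set
  InD⊔ x = x ⊔ x ≡ x

  Pure : Set
  Pure = ∀ x → InD⊓ x ⊎ InD⊔ x

  TypeI : Set
  TypeI = InD⊔ ⊤ × (∀ x → InD⊔ x → x ≡ ⊤)

  TypeII : Set
  TypeII = InD⊓ ⊥ × (∀ x → InD⊓ x → x ≡ ⊥)

  record Con : Set₁ where
    field
      R      : Carrier → Carrier → Set
      refl   : ∀ x → R x x
      sym    : ∀ {x y} → R x y → R y x
      trans  : ∀ {x y z} → R x y → R y z → R x z
      cong-⊓ : ∀ {x y u v} → R x y → R u v → R (x ⊓ u) (y ⊓ v)
      cong-⊔ : ∀ {x y u v} → R x y → R u v → R (x ⊔ u) (y ⊔ v)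
      cong-¬ : ∀ {x y} → R x y → R (¬ x) (¬ y)
      cong-⌟ : ∀ {x y} → R x y → R (⌟ x) (⌟ y)

  -- A relation on the subset D_⊓ is represented as a relation on the carrier
  -- that only relates elements of D_⊓ (the nullary operations ⊥, ¬⊥ impose
  -- no condition beyond reflexivity).
  record Con⊓ : Set₁ where
    field
      R      : Carrier → Carrier → Set
      dom    : ∀ {x y} → R x y → InD⊓ x × InD⊓ y
      refl   : ∀ x → InD⊓ x → R x x
      sym    : ∀ {x y} → R x y → R y x
      trans  : ∀ {x y z} → R x y → R y z → R x z
      cong-⊓ : ∀ {x y u v} → R x y → R u v → R (x ⊓ u) (y ⊓ v)
      cong-∨ : ∀ {x y u v} → R x y → R u v → R (x ∨ u) (y ∨ v)
      cong-¬ : ∀ {x y} → R x y → R (¬ x) (¬ y)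

  record Con⊔ : Set₁ where
    field
      R      : Carrier → Carrier → Set
      dom    : ∀ {x y} → R x y → InD⊔ x × InD⊔ y
      refl   : ∀ x → InD⊔ x → R x x
      sym    : ∀ {x y} → R x y → R y x
      trans  : ∀ {x y z} → R x y → R y z → R x z
      cong-∧ : ∀ {x y u v} → R x y → R u v → R (x ∧ u) (y ∧ v)
      cong-⊔ : ∀ {x y u v} → R x y → R u v → R (x ⊔ u) (y ⊔ v)
      cong-⌟ : ∀ {x y} → R x y → R (⌟ x) (⌟ y)

_⊆₂_ : {A : Set} → (A → A → Set) → (A → A → Set) → Set
R ⊆₂ S = ∀ {x y} → R x y → S x y

-- Lattice isomorphism between two congruence lattices, each ordered by
-- inclusion of the underlying relations (congruences equal iff they are the
-- same relation, i.e. mutual inclusion).  A lattice isomorphism is given as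
-- an order isomorphism: maps f, g, both monotone, mutually inverse.
record ConIso {A : Set} (C₁ C₂ : Set₁)
              (R₁ : C₁ → A → A → Set) (R₂ : C₂ → A → A → Set) : Set₁ where
  field
    to      : C₁ → C₂
    from    : C₂ → C₁
    to-mono   : ∀ θ ψ → R₁ θ ⊆₂ R₁ ψ → R₂ (to θ) ⊆₂ R₂ (to ψ)
    from-mono : ∀ θ ψ → R₂ θ ⊆₂ R₂ ψ → R₁ (from θ) ⊆₂ R₁ (from ψ)
    from-to : ∀ θ → (R₁ (from (to θ)) ⊆₂ R₁ θ) × (R₁ θ ⊆₂ R₁ (from (to θ)))
    to-from : ∀ ψ → (R₂ (to (from ψ)) ⊆₂ R₂ ψ) × (R₂ ψ ⊆₂ R₂ (to (from ψ)))

module _ (D : DBA) where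
  open DBA D

  ConD≅ConD⊓ : Set₁
  ConD≅ConD⊓ = ConIso Con Con⊓ Con.R Con⊓.R

  ConD≅ConD⊔ : Set₁
  ConD≅ConD⊔ = ConIso Con Con⊔ Con.R Con⊔.R

{-# OPTIONS --safe #-}
-- In a DBA of type I every element x ⊔ y lies in D_⊔ = {⊤}, so ⊔ and ⌟ are
-- constant with value ⊤, and ⊤ ∈ D_⊓ by the mixed law; purity then puts every
-- element into D_⊓.  Hence D and D_⊓ have the same carrier, the congruence
-- conditions for ⊔ and ⌟ hold by reflexivity at ⊤, and ∨ is expressed by ⊓
-- and ¬: the two congruence lattices consist of the same relations.  Type II
-- follows by duality, exchanging (⊓, ¬, ⊥) with (⊔, ⌟, ⊤).
module Submission where

open import Defs
open import Data.Product using (_×_; _,_; proj₁; proj₂)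
open import Data.Sum using (inj₁; inj₂; swap)
import Relation.Binary.PropositionalEquality as ≡
open ≡ using (_≡_; cong; cong₂; subst; subst₂; module ≡-Reasoning)
open ≡-Reasoning

product-idempotent : {A : Set} (_∙_ : A → A → A)
  → (∀ x y → (x ∙ x) ∙ y ≡ x ∙ y)
  → (∀ x y → x ∙ y ≡ y ∙ x)
  → (∀ x y z → x ∙ (y ∙ z) ≡ (x ∙ y) ∙ z)
  → ∀ x y → (x ∙ y) ∙ (x ∙ y) ≡ x ∙ y
product-idempotent _∙_ idem′ comm assoc x y = begin
  (x ∙ y) ∙ (x ∙ y)   ≡⟨ assoc (x ∙ y) x y ⟩
  ((x ∙ y) ∙ x) ∙ y   ≡⟨ cong (_∙ y) (comm (x ∙ y) x) ⟩
  (x ∙ (x ∙ y)) ∙ y   ≡⟨ cong (_∙ y) (assoc x x y) ⟩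
  ((x ∙ x) ∙ y) ∙ y   ≡⟨ cong (_∙ y) (idem′ x y) ⟩
  (x ∙ y) ∙ y         ≡⟨ ≡.sym (assoc x y y) ⟩
  x ∙ (y ∙ y)         ≡⟨ comm x (y ∙ y) ⟩
  (y ∙ y) ∙ x         ≡⟨ idem′ y x ⟩
  y ∙ x               ≡⟨ comm y x ⟩
  x ∙ y               ∎

module TypeI (D : DBA) (pure : DBA.Pure D) (typeI : DBA.TypeI D) where
  open DBA D

  ⊔-constant : ∀ x y → x ⊔ y ≡ ⊤
  ⊔-constant x y = proj₂ typeI (x ⊔ y) (product-idempotent _⊔_ ⊔-idem′ ⊔-comm ⊔-assoc x y)

  ⌟-constant : ∀ x → ⌟ x ≡ ⊤
  ⌟-constant x = begin
    ⌟ x        ≡⟨ ≡.sym (⌟-⊔-idem x) ⟩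
    ⌟ (x ⊔ x)  ≡⟨ cong ⌟_ (⊔-constant x x) ⟩
    ⌟ ⊤        ≡⟨ ⌟⊤ ⟩
    ⊥ ⊔ ⊥      ≡⟨ ⊔-constant ⊥ ⊥ ⟩
    ⊤          ∎

  ⊤∈D⊓ : InD⊓ ⊤
  ⊤∈D⊓ = begin
    ⊤ ⊓ ⊤              ≡⟨ cong₂ _⊓_ (≡.sym (proj₁ typeI)) (≡.sym (proj₁ typeI)) ⟩
    (⊤ ⊔ ⊤) ⊓ (⊤ ⊔ ⊤)  ≡⟨ ≡.sym (mixed ⊤) ⟩
    (⊤ ⊓ ⊤) ⊔ (⊤ ⊓ ⊤)  ≡⟨ ⊔-constant _ _ ⟩
    ⊤                  ∎

  all-in-D⊓ : ∀ x → InD⊓ x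
  all-in-D⊓ x with pure x
  ... | inj₁ x∈D⊓ = x∈D⊓
  ... | inj₂ x∈D⊔ = subst InD⊓ (≡.sym (proj₂ typeI x x∈D⊔)) ⊤∈D⊓

  Con⇒Con⊓ : Con → Con⊓
  Con⇒Con⊓ θ = record
    { R = R ; dom = λ {x} {y} _ → all-in-D⊓ x , all-in-D⊓ y
    ; refl = λ x _ → refl x ; sym = sym ; trans = trans
    ; cong-⊓ = cong-⊓
    ; cong-∨ = λ p q → cong-¬ (cong-⊓ (cong-¬ p) (cong-¬ q))
    ; cong-¬ = cong-¬ }
    where open Con θ

  Con⊓⇒Con : Con⊓ → Con
  Con⊓⇒Con ψ = record
    { R = R ; refl = λ x → refl x (all-in-D⊓ x) ; sym = sym ; trans = trans
    ; cong-⊓ = cong-⊓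
    ; cong-⊔ = λ {x} {y} {u} {v} _ _ →
        subst₂ R (≡.sym (⊔-constant x u)) (≡.sym (⊔-constant y v)) R⊤⊤
    ; cong-¬ = cong-¬
    ; cong-⌟ = λ {x} {y} _ → subst₂ R (≡.sym (⌟-constant x)) (≡.sym (⌟-constant y)) R⊤⊤ }
    where
    open Con⊓ ψ
    R⊤⊤ : R ⊤ ⊤
    R⊤⊤ = refl ⊤ ⊤∈D⊓

  ConD≅ConD⊓-typeI : ConD≅ConD⊓ D
  ConD≅ConD⊓-typeI = record
    { to = Con⇒Con⊓ ; from = Con⊓⇒Con
    ; to-mono = λ _ _ h → h ; from-mono = λ _ _ h → h
    ; from-to = λ _ → (λ h → h) , (λ h → h)
    ; to-from = λ _ → (λ h → h) , (λ h → h) }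

dual : DBA → DBA
dual D = record
  { Carrier = Carrier ; _⊓_ = _⊔_ ; _⊔_ = _⊓_ ; ¬_ = ⌟_ ; ⌟_ = ¬_ ; ⊥ = ⊤ ; ⊤ = ⊥
  ; ⊓-idem′ = ⊔-idem′ ; ⊔-idem′ = ⊓-idem′ ; ⊓-comm = ⊔-comm ; ⊔-comm = ⊓-comm
  ; ⊓-assoc = ⊔-assoc ; ⊔-assoc = ⊓-assoc ; ⊓-abs-⊔ = ⊔-abs-⊓ ; ⊔-abs-⊓ = ⊓-abs-⊔
  ; ⊓-abs-∨ = ⊔-abs-∧ ; ⊔-abs-∧ = ⊓-abs-∨
  ; ⊓-distrib-∨ = ⊔-distrib-∧ ; ⊔-distrib-∧ = ⊓-distrib-∨
  ; ¬¬-⊓ = ⌟⌟-⊔ ; ⌟⌟-⊔ = ¬¬-⊓ ; ¬-⊓-idem = ⌟-⊔-idem ; ⌟-⊔-idem = ¬-⊓-idem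
  ; ⊓-compl = ⊔-compl ; ⊔-compl = ⊓-compl ; ¬⊥ = ⌟⊤ ; ⌟⊤ = ¬⊥ ; ¬⊤ = ⌟⊥ ; ⌟⊥ = ¬⊤
  ; mixed = λ x → ≡.sym (mixed x) }
  where open DBA D

module Duality (D : DBA) where
  open DBA D
  module Dᵒ = DBA (dual D)

  Pure-dual : Pure → Dᵒ.Pure
  Pure-dual pure x = swap (pure x)

  Con⇒Conᵒ : Con → Dᵒ.Con
  Con⇒Conᵒ θ = record
    { R = R ; refl = refl ; sym = sym ; trans = trans
    ; cong-⊓ = cong-⊔ ; cong-⊔ = cong-⊓ ; cong-¬ = cong-⌟ ; cong-⌟ = cong-¬ }
    where open Con θ

  Conᵒ⇒Con : Dᵒ.Con → Con
  Conᵒ⇒Con θ = record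
    { R = R ; refl = refl ; sym = sym ; trans = trans
    ; cong-⊓ = cong-⊔ ; cong-⊔ = cong-⊓ ; cong-¬ = cong-⌟ ; cong-⌟ = cong-¬ }
    where open Dᵒ.Con θ

  Con⊔⇒Conᵒ⊓ : Con⊔ → Dᵒ.Con⊓
  Con⊔⇒Conᵒ⊓ ψ = record
    { R = R ; dom = dom ; refl = refl ; sym = sym ; trans = trans
    ; cong-⊓ = cong-⊔ ; cong-∨ = cong-∧ ; cong-¬ = cong-⌟ }
    where open Con⊔ ψ

  Conᵒ⊓⇒Con⊔ : Dᵒ.Con⊓ → Con⊔
  Conᵒ⊓⇒Con⊔ ψ = record
    { R = R ; dom = dom ; refl = refl ; sym = sym ; trans = trans
    ; cong-∧ = cong-∨ ; cong-⊔ = cong-⊓ ; cong-⌟ = cong-¬ }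
    where open Dᵒ.Con⊓ ψ

  ConD≅ConD⊔-dual : ConD≅ConD⊓ (dual D) → ConD≅ConD⊔ D
  ConD≅ConD⊔-dual iso = record
    { to = λ θ → Conᵒ⊓⇒Con⊔ (to (Con⇒Conᵒ θ))
    ; from = λ ψ → Conᵒ⇒Con (from (Con⊔⇒Conᵒ⊓ ψ))
    ; to-mono = λ θ ψ → to-mono (Con⇒Conᵒ θ) (Con⇒Conᵒ ψ)
    ; from-mono = λ θ ψ → from-mono (Con⊔⇒Conᵒ⊓ θ) (Con⊔⇒Conᵒ⊓ ψ)
    ; from-to = λ θ → from-to (Con⇒Conᵒ θ)
    ; to-from = λ ψ → to-from (Con⊔⇒Conᵒ⊓ ψ) }
    where open ConIso iso

  -- TypeII D is definitionally TypeI (dual D).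
  ConD≅ConD⊔-typeII : Pure → TypeII → ConD≅ConD⊔ D
  ConD≅ConD⊔-typeII pure typeII =
    ConD≅ConD⊔-dual (TypeI.ConD≅ConD⊓-typeI (dual D) (Pure-dual pure) typeII)

corollary3p14 : (D : DBA) → DBA.Pure D →
    (DBA.TypeI D → ConD≅ConD⊓ D) × (DBA.TypeII D → ConD≅ConD⊔ D)
corollary3p14 D pure = TypeI.ConD≅ConD⊓-typeI D pure , Duality.ConD≅ConD⊔-typeII D pure
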